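{- Let $G$ be a uniquely $C_4^{+}$-saturated graph. Then $G$ contains neither the bowknot graph, nor the house graph, nor $K_{2,3}$ as a subgraph.
   Context: All graphs are finite, simple and undirected. $C_4^{+}$ (the diamond) is the graph obtained from a $4$-cycle by adding one chord, i.e. $K_4$ minus an edge. For a graph $H$, a graph $G$ is uniquely $H$-saturated if $G$ contains no subgraph isomorphic to $H$, but for every pair of non-adjacent vertices $u,v$ of $G$, the graph $G+uv$ contains exactly one subgraph isomorphic to $H$. The bowknot graph consists of two triangles sharing exactly one vertex. The house graph is the graph obtained by adding one chord to the $5$-cycle $C_5$. "Contains as a subgraph" means contains a (not necessarily induced) subgraph isomorphic to it. -}

module Defs where

open import Data.Nat using (ℕ; _≡ᵇ_)
open import Data.Fin using (Fin; toℕ; _≟_)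
open import Data.Bool using (Bool; true; false; _∨_; _∧_; if_then_else_)
open import Data.List using (List; []; _∷_)
open import Data.Bool.ListAction using (any)
open import Data.Product using (Σ; _×_; _,_)
open import Relation.Binary.PropositionalEquality using (_≡_)
open import Relation.Nullary using (¬_; does)
open import Function.Definitions using (Injective)

record Graph : Set where
  field
    n     : ℕ
    adj   : Fin n → Fin n → Bool
    sym   : ∀ x y → adj x y ≡ adj y x
    irref : ∀ x → adj x x ≡ false
open Graph public

Adj : (G : Graph) → Fin (n G) → Fin (n G) → Set
Adj G x y = adj G x y ≡ true

eqv : ∀ {k} → Fin k → Fin k → Bool
eqv x y = does (x ≟ y)

addEdge : (G : Graph) (u v : Fin (n G)) → ¬ u ≡ v → Graph
addEdge G u v u≢v = record
  { n = n G
  ; adj = λ x y → adj G x y ∨ ((eqv x u ∧ eqv y v) ∨ (eqv x v ∧ eqv y u))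
  ; sym = symP
  ; irref = irrP }
  where
  open import Data.Bool.Properties using (∨-comm; ∧-comm)
  open import Relation.Binary.PropositionalEquality using (refl; cong₂; trans)
  open import Relation.Nullary using (yes; no)
  open import Data.Empty using (⊥-elim)
  symP : ∀ x y → adj G x y ∨ ((eqv x u ∧ eqv y v) ∨ (eqv x v ∧ eqv y u))
               ≡ adj G y x ∨ ((eqv y u ∧ eqv x v) ∨ (eqv y v ∧ eqv x u))
  symP x y = cong₂ _∨_ (sym G x y)
    (trans (∨-comm (eqv x u ∧ eqv y v) (eqv x v ∧ eqv y u))
           (cong₂ _∨_ (∧-comm (eqv x v) (eqv y u)) (∧-comm (eqv x u) (eqv y v))))
  irrP : ∀ x → adj G x x ∨ ((eqv x u ∧ eqv x v) ∨ (eqv x v ∧ eqv x u)) ≡ false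
  irrP x rewrite irref G x with x ≟ u | x ≟ v
  ... | yes refl | yes refl = ⊥-elim (u≢v refl)
  ... | yes _ | no _ = refl
  ... | no _ | yes _ = refl
  ... | no _ | no _ = refl

fromEdges : (m : ℕ) → List (ℕ × ℕ) → Fin m → Fin m → Bool
fromEdges m es i j = any (λ { (a , b) → ((toℕ i ≡ᵇ a) ∧ (toℕ j ≡ᵇ b)) ∨ ((toℕ i ≡ᵇ b) ∧ (toℕ j ≡ᵇ a)) }) es

Embedding : (m : ℕ) (H : Fin m → Fin m → Bool) (G : Graph) → Set
Embedding m H G =
  Σ (Fin m → Fin (n G)) λ f → Injective _≡_ _≡_ f × (∀ i j → H i j ≡ true → Adj G (f i) (f j))

Contains : (m : ℕ) (H : Fin m → Fin m → Bool) (G : Graph) → Set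
Contains m H G = Embedding m H G

-- Two embeddings determine the same subgraph (same vertex set and same edge set)
-- iff they differ by an automorphism of H.
SameCopy : (m : ℕ) (H : Fin m → Fin m → Bool) (G : Graph) → Embedding m H G → Embedding m H G → Set
SameCopy m H G (f , _) (g , _) =
  Σ (Fin m → Fin m) λ σ → (∀ i → g i ≡ f (σ i)) × (∀ i j → H (σ i) (σ j) ≡ H i j)

ContainsExactlyOne : (m : ℕ) (H : Fin m → Fin m → Bool) (G : Graph) → Set
ContainsExactlyOne m H G =
  Embedding m H G × (∀ (e₁ e₂ : Embedding m H G) → SameCopy m H G e₁ e₂)

UniquelySaturated : (m : ℕ) (H : Fin m → Fin m → Bool) (G : Graph) → Set
UniquelySaturated m H G =
  ¬ Contains m H G ×
  (∀ (u v : Fin (n G)) (u≢v : ¬ u ≡ v) → adj G u v ≡ false →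
     ContainsExactlyOne m H (addEdge G u v u≢v))

diamond : Fin 4 → Fin 4 → Bool
diamond = fromEdges 4 ((0 , 1) ∷ (1 , 2) ∷ (2 , 3) ∷ (3 , 0) ∷ (0 , 2) ∷ [])

bowknot : Fin 5 → Fin 5 → Bool
bowknot = fromEdges 5 ((0 , 1) ∷ (1 , 2) ∷ (2 , 0) ∷ (0 , 3) ∷ (3 , 4) ∷ (4 , 0) ∷ [])

house : Fin 5 → Fin 5 → Bool
house = fromEdges 5 ((0 , 1) ∷ (1 , 2) ∷ (2 , 3) ∷ (3 , 4) ∷ (4 , 0) ∷ (0 , 2) ∷ [])

K23 : Fin 5 → Fin 5 → Bool
K23 = fromEdges 5 ((0 , 2) ∷ (0 , 3) ∷ (0 , 4) ∷ (1 , 2) ∷ (1 , 3) ∷ (1 , 4) ∷ [])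

{-# OPTIONS --safe #-}
-- Each of the three patterns P has a pair u v such that P + uv contains two diamonds on
-- different vertex sets. Take a copy of P in G. If the images of u and v are adjacent in G,
-- one of those diamonds already lies in G; otherwise both lie in G + uv and are different
-- copies. Either way unique diamond-saturation fails.
module Submission where

open import Defs
open import Data.Nat using (ℕ)
open import Data.Bool using (Bool; true; false; T; _∧_; _∨_)
open import Data.Bool.Properties using (T-≡; T-∧; T-∨; ∨-zeroʳ) renaming (_≟_ to _≟ᵇ_)
open import Data.Fin using (Fin; #_; _≟_)
open import Data.Fin.Properties using (all?; any?)
open import Data.Product using (_×_; _,_; proj₁; proj₂; ∃-syntax)
import Data.Product as Product
open import Data.Sum using (_⊎_; inj₁; inj₂)
import Data.Sum as Sum
open import Data.Vec using (Vec; []; _∷_; lookup)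
open import Data.Empty using (⊥)
open import Function using (_∘_; id)
open import Function.Bundles using (Equivalence)
open import Relation.Binary.PropositionalEquality using (_≡_; _≢_; refl; trans; cong)
open import Relation.Nullary using (¬_; Dec; yes)
open import Relation.Nullary.Decidable using (True; toWitness; dec-true; _×-dec_; _→-dec_; ¬?)

open Equivalence using (to; from)

eqv-sound : ∀ {k} {a b : Fin k} → T (eqv a b) → a ≡ b
eqv-sound {a = a} {b} _ with a ≟ b
... | yes a≡b = a≡b

eqv-pair : ∀ {k} {a b c d : Fin k} → T (eqv a b ∧ eqv c d) → a ≡ b × c ≡ d
eqv-pair = Product.map eqv-sound eqv-sound ∘ to T-∧

Adj-sym : (G : Graph) {x y : Fin (n G)} → Adj G x y → Adj G y x
Adj-sym G {x} {y} xy = trans (Graph.sym G y x) xy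

module _ {G : Graph} {u v : Fin (n G)} (u≢v : u ≢ v) where

  addEdge-⊇ : ∀ x y → Adj G x y → Adj (addEdge G u v u≢v) x y
  addEdge-⊇ _ _ xy = cong (_∨ _) xy

  addEdge-new : Adj (addEdge G u v u≢v) u v
  addEdge-new rewrite dec-true (u ≟ u) refl | dec-true (v ≟ v) refl = ∨-zeroʳ (adj G u v)

  addEdge-adj : ∀ {x y} → Adj (addEdge G u v u≢v) x y →
                Adj G x y ⊎ (x ≡ u × y ≡ v) ⊎ (x ≡ v × y ≡ u)
  addEdge-adj xy = Sum.map (to T-≡) (Sum.map eqv-pair eqv-pair ∘ to T-∨) (to T-∨ (from T-≡ xy))

addEdge-hom : ∀ {G G′ : Graph} {u v} (u≢v : u ≢ v) (g : Fin (n G) → Fin (n G′)) →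
              (∀ x y → Adj G x y → Adj G′ (g x) (g y)) → Adj G′ (g u) (g v) →
              ∀ x y → Adj (addEdge G u v u≢v) x y → Adj G′ (g x) (g y)
addEdge-hom {G} {G′} {u} {v} u≢v g g-hom guv x y xy with addEdge-adj {G} {u} {v} u≢v {x} {y} xy
... | inj₁ Gxy                 = g-hom x y Gxy
... | inj₂ (inj₁ (refl , refl)) = guv
... | inj₂ (inj₂ (refl , refl)) = Adj-sym G′ guv

addEdge-redundant : ∀ {G : Graph} {u v} (u≢v : u ≢ v) → Adj G u v →
                    ∀ x y → Adj (addEdge G u v u≢v) x y → Adj G x y
addEdge-redundant {G} u≢v = addEdge-hom {G} {G} u≢v id (λ _ _ → id)

module _ {m} {H : Fin m → Fin m → Bool} where

  _∘ᴱ_ : ∀ {P G : Graph} → Embedding (n P) (adj P) G → Embedding m H P → Embedding m H G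
  (f , f-inj , f-adj) ∘ᴱ (g , g-inj , g-adj) =
    f ∘ g , (λ eq → g-inj (f-inj eq)) , λ i j → f-adj _ _ ∘ g-adj i j

  HasVertexOutside : (G : Graph) → Embedding m H G → Embedding m H G → Set
  HasVertexOutside G (f , _) (g , _) = ∃[ k ] ∀ i → g k ≢ f i

  outside⇒¬SameCopy : ∀ G {e₁ e₂ : Embedding m H G} →
                      HasVertexOutside G e₁ e₂ → ¬ SameCopy m H G e₁ e₂
  outside⇒¬SameCopy _ (k , outside) (σ , g≡f∘σ , _) = outside (σ k) (g≡f∘σ k)

embedding-addEdge : ∀ {P G : Graph} (e : Embedding (n P) (adj P) G) {u v} (u≢v : u ≢ v) →
                    (fu≢fv : proj₁ e u ≢ proj₁ e v) →
                    Embedding (n P) (adj (addEdge P u v u≢v)) (addEdge G (proj₁ e u) (proj₁ e v) fu≢fv)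
embedding-addEdge {P} {G} (f , f-inj , f-adj) u≢v fu≢fv =
  f , f-inj , addEdge-hom {P} {addEdge G (f _) (f _) fu≢fv} u≢v f
                (λ x y → addEdge-⊇ {G} fu≢fv _ _ ∘ f-adj x y) (addEdge-new {G} fu≢fv)

record AmbiguousPair (m : ℕ) (H : Fin m → Fin m → Bool) (P : Graph) : Set where
  field
    u v           : Fin (n P)
    u≢v           : u ≢ v
    copy₁ copy₂   : Embedding m H (addEdge P u v u≢v)
    copy₂-outside : HasVertexOutside (addEdge P u v u≢v) copy₁ copy₂

module _ {m} {H : Fin m → Fin m → Bool} (G : Graph) (saturated : UniquelySaturated m H G) where

  saturated-no-two-copies : ∀ {u v} (u≢v : u ≢ v) →
                            (e₁ e₂ : Embedding m H (addEdge G u v u≢v)) → ¬ SameCopy m H (addEdge G u v u≢v) e₁ e₂ → ⊥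
  saturated-no-two-copies {u} {v} u≢v e₁@(f , f-inj , f-adj) e₂ distinct with adj G u v in uv
  ... | true  = proj₁ saturated
                  (f , f-inj , λ i j → addEdge-redundant {G} u≢v uv _ _ ∘ f-adj i j)
  ... | false = distinct (proj₂ (proj₂ saturated u v u≢v uv) e₁ e₂)

  ambiguous⇒forbidden : ∀ {P} → AmbiguousPair m H P → ¬ Embedding (n P) (adj P) G
  ambiguous⇒forbidden {P} amb e@(f , f-inj , _) =
    saturated-no-two-copies fu≢fv c₁ c₂ (outside⇒¬SameCopy G⁺ {c₁} {c₂} c₂-outside)
    where
    open AmbiguousPair amb
    fu≢fv : f u ≢ f v
    fu≢fv = u≢v ∘ f-inj
    P⁺ = addEdge P u v u≢v
    G⁺ = addEdge G (f u) (f v) fu≢fv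
    e⁺ : Embedding (n P) (adj P⁺) G⁺
    e⁺ = embedding-addEdge {P} {G} e u≢v fu≢fv
    c₁ c₂ : Embedding m H G⁺
    c₁ = _∘ᴱ_ {P = P⁺} {G = G⁺} e⁺ copy₁
    c₂ = _∘ᴱ_ {P = P⁺} {G = G⁺} e⁺ copy₂
    c₂-outside : HasVertexOutside G⁺ c₁ c₂
    c₂-outside = Product.map₂ (λ outside i → outside i ∘ f-inj) copy₂-outside

simple? : ∀ {m} (H : Fin m → Fin m → Bool) →
          Dec ((∀ x y → H x y ≡ H y x) × (∀ x → H x x ≡ false))
simple? H = all? (λ x → all? λ y → H x y ≟ᵇ H y x) ×-dec all? (λ x → H x x ≟ᵇ false)

simpleGraph : (m : ℕ) (H : Fin m → Fin m → Bool) → True (simple? H) → Graph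
simpleGraph m H simple = record
  { n = m ; adj = H ; sym = proj₁ (toWitness simple) ; irref = proj₂ (toWitness simple) }

module _ {m} (H : Fin m → Fin m → Bool) (G : Graph) where

  embedding? : (σ : Fin m → Fin (n G)) →
               Dec ((∀ i j → σ i ≡ σ j → i ≡ j) × (∀ i j → H i j ≡ true → Adj G (σ i) (σ j)))
  embedding? σ = all? (λ i → all? λ j → σ i ≟ σ j →-dec i ≟ j)
           ×-dec all? (λ i → all? λ j → H i j ≟ᵇ true →-dec adj G (σ i) (σ j) ≟ᵇ true)

  checkedEmbedding : (σ : Fin m → Fin (n G)) → True (embedding? σ) → Embedding m H G
  checkedEmbedding σ ok = σ , (λ {i} {j} → proj₁ (toWitness ok) i j) , proj₂ (toWitness ok)

module _ {m} {H : Fin m → Fin m → Bool} {P : Graph} where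

  checkedAmbiguousPair : (u v : Fin (n P)) (u≢v : u ≢ v) (σ₁ σ₂ : Vec (Fin (n P)) m) →
                         let P⁺ = addEdge P u v u≢v in
                         True (embedding? H P⁺ (lookup σ₁)) → True (embedding? H P⁺ (lookup σ₂)) →
                         True (any? λ k → all? λ i → ¬? (lookup σ₂ k ≟ lookup σ₁ i)) →
                         AmbiguousPair m H P
  checkedAmbiguousPair u v u≢v σ₁ σ₂ ok₁ ok₂ outside = record
    { u = u ; v = v ; u≢v = u≢v
    ; copy₁ = checkedEmbedding H (addEdge P u v u≢v) (lookup σ₁) ok₁
    ; copy₂ = checkedEmbedding H (addEdge P u v u≢v) (lookup σ₂) ok₂
    ; copy₂-outside = toWitness outside
    }

-- A diamond is listed as its 4-cycle a b c d; its chord is ac.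
bowknot-ambiguous : AmbiguousPair 4 diamond (simpleGraph 5 bowknot _)
bowknot-ambiguous =
  checkedAmbiguousPair (# 1) (# 3) (λ ()) (# 0 ∷ # 2 ∷ # 1 ∷ # 3 ∷ []) (# 0 ∷ # 4 ∷ # 3 ∷ # 1 ∷ []) _ _ _

house-ambiguous : AmbiguousPair 4 diamond (simpleGraph 5 house _)
house-ambiguous =
  checkedAmbiguousPair (# 0) (# 3) (λ ()) (# 0 ∷ # 1 ∷ # 2 ∷ # 3 ∷ []) (# 0 ∷ # 2 ∷ # 3 ∷ # 4 ∷ []) _ _ _

K23-ambiguous : AmbiguousPair 4 diamond (simpleGraph 5 K23 _)
K23-ambiguous =
  checkedAmbiguousPair (# 0) (# 1) (λ ()) (# 0 ∷ # 2 ∷ # 1 ∷ # 3 ∷ []) (# 0 ∷ # 2 ∷ # 1 ∷ # 4 ∷ []) _ _ _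

lemma2p3 : (G : Graph) → UniquelySaturated 4 diamond G →
    ¬ Contains 5 bowknot G × ¬ Contains 5 house G × ¬ Contains 5 K23 G
lemma2p3 G saturated =
    ambiguous⇒forbidden G saturated bowknot-ambiguous
  , ambiguous⇒forbidden G saturated house-ambiguous
  , ambiguous⇒forbidden G saturated K23-ambiguous
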